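{- Let $\mathcal{D}_1\subseteq\mathcal{L}(A)$ and $\mathcal{D}_2\subseteq\mathcal{L}(B)$ be Condorcet domains on disjoint finite sets of alternatives $A$ and $B$, and let $u\in\mathcal{D}_1$ and $v\in\mathcal{D}_2$ be arbitrary. Then $$(\mathcal{D}_1\otimes\mathcal{D}_2)(u,v):=(\mathcal{D}_1\odot\mathcal{D}_2)\cup(u\oplus v)$$ is a Condorcet domain on $A\cup B$. Moreover, if $\mathcal{D}_1$ and $\mathcal{D}_2$ are peak-pit domains, then so is $(\mathcal{D}_1\otimes\mathcal{D}_2)(u,v)$.
   Context: $\mathcal{L}(X)$ denotes the set of strict linear orders on a finite set $X$, written as strings (the string $a_1a_2\dots a_n$ means $a_1>a_2>\dots>a_n$). A profile over a domain $\mathcal{D}\subseteq\mathcal{L}(X)$ is a finite sequence of orders from $\mathcal{D}$; its majority relation puts $a$ above $b$ if strictly more orders of the profile rank $a$ above $b$ than $b$ above $a$. $\mathcal{D}$ is a Condorcet domain if for every profile over $\mathcal{D}$ with an odd number of orders the majority relation is transitive. For distinct $a,b,c$, $x\in\{a,b,c\}$, $i\in\{1,2,3\}$, a domain satisfies the never condition $xN_{\{a,b,c\}}i$ if no order in it ranks $x$ in position $i$ among $a,b,c$ (1 = top, 3 = bottom). A peak-pit domain is one which, for every triple of distinct alternatives $\{a,b,c\}$, satisfies some $xN_{\{a,b,c\}}1$ or some $xN_{\{a,b,c\}}3$ with $x\in\{a,b,c\}$. For disjoint $A,B$: the concatenation is $\mathcal{D}_1\odot\mathcal{D}_2=\{xy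 : x\in\mathcal{D}_1,\ y\in\mathcal{D}_2\}$, where $xy$ is the order on $A\cup B$ ranking all of $A$ above all of $B$, ordered by $x$ on $A$ and by $y$ on $B$. For $u\in\mathcal{L}(A)$, $v\in\mathcal{L}(B)$, a shuffle of $u$ and $v$ is an order $w\in\mathcal{L}(A\cup B)$ whose restriction to $A$ is $u$ and whose restriction to $B$ is $v$; $u\oplus v$ denotes the set of all shuffles of $u$ and $v$. -}

module Defs where

open import Data.Nat using (ℕ; _<_)
open import Data.Nat.Properties using ()
open import Data.Bool using (Bool; true; false; if_then_else_)
open import Data.Fin using (Fin)
import Data.Fin.Properties as FinP
open import Data.Sum using (_⊎_; inj₁; inj₂)
open import Data.Sum.Properties using (≡-dec)
open import Data.List using (List; []; _∷_; _++_; map; length; filterᵇ; allFin)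
open import Data.List.Relation.Unary.All using (All)
open import Data.List.Relation.Binary.Permutation.Propositional using (_↭_)
open import Data.Product using (Σ; ∃; ∃-syntax; _×_; _,_)
open import Relation.Binary.PropositionalEquality using (_≡_; _≢_)
open import Relation.Binary.Definitions using (DecidableEquality)
open import Relation.Nullary using (¬_; does)

-- Alternatives are elements of a type X with decidable equality; the set of
-- all alternatives is given by a duplicate-free enumeration 'univ : List X'.
-- A strict linear order on the alternatives is written as a string
-- (a list, top first) which is a permutation of 'univ'.

module _ {X : Set} (_≟_ : DecidableEquality X) where

  elem : X → List X → Bool
  elem b []       = false
  elem b (x ∷ w) = if does (b ≟ x) then true else elem b w

  before : List X → X → X → Bool
  before []      a b = false
  before (x ∷ w) a b =
    if does (x ≟ a) then elem b w
    else (if does (x ≟ b) then false else before w a b)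

  support : List (List X) → X → X → ℕ
  support P a b = length (filterᵇ (λ w → before w a b) P)

  Maj : List (List X) → X → X → Set
  Maj P a b = support P b a < support P a b

  Domain : Set₁
  Domain = List X → Set

  IsDomainOn : List X → Domain → Set
  IsDomainOn univ D = ∀ w → D w → w ↭ univ

  data Odd : ℕ → Set where
    odd1  : Odd 1
    odd+2 : ∀ {k} → Odd k → Odd (Data.Nat.suc (Data.Nat.suc k))

  Condorcet : Domain → Set
  Condorcet D = ∀ (P : List (List X)) → All D P → Odd (length P) →
    ∀ a b c → Maj P a b → Maj P b c → Maj P a c

  NeverTop : Domain → X → X → X → Set
  NeverTop D x y z = ∀ w → D w → ¬ (before w x y ≡ true × before w x z ≡ true)

  NeverBottom : Domain → X → X → X → Set
  NeverBottom D x y z = ∀ w → D w → ¬ (before w y x ≡ true × before w z x ≡ true)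

  PeakPitTriple : Domain → X → X → X → Set
  PeakPitTriple D a b c =
    (NeverTop D a b c ⊎ NeverBottom D a b c) ⊎
    ((NeverTop D b a c ⊎ NeverBottom D b a c) ⊎
     (NeverTop D c a b ⊎ NeverBottom D c a b))

  PeakPit : Domain → Set
  PeakPit D = ∀ a b c → a ≢ b → b ≢ c → a ≢ c → PeakPitTriple D a b c

-- Disjoint sets A = Fin n and B = Fin m; A ∪ B is Fin n ⊎ Fin m.

_≟F_ : ∀ {n} → DecidableEquality (Fin n)
_≟F_ = FinP._≟_

_≟AB_ : ∀ {n m} → DecidableEquality (Fin n ⊎ Fin m)
_≟AB_ = ≡-dec FinP._≟_ FinP._≟_

univAB : ∀ n m → List (Fin n ⊎ Fin m)
univAB n m = map inj₁ (allFin n) ++ map inj₂ (allFin m)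

restrictA : ∀ {n m} → List (Fin n ⊎ Fin m) → List (Fin n)
restrictA []            = []
restrictA (inj₁ a ∷ w) = a ∷ restrictA w
restrictA (inj₂ _ ∷ w) = restrictA w

restrictB : ∀ {n m} → List (Fin n ⊎ Fin m) → List (Fin m)
restrictB []            = []
restrictB (inj₁ _ ∷ w) = restrictB w
restrictB (inj₂ b ∷ w) = b ∷ restrictB w

Concat : ∀ {n m} → (List (Fin n) → Set) → (List (Fin m) → Set) →
         List (Fin n ⊎ Fin m) → Set
Concat D₁ D₂ w = ∃[ x ] ∃[ y ] (D₁ x × D₂ y × w ≡ map inj₁ x ++ map inj₂ y)

Shuffle : ∀ {n m} → List (Fin n) → List (Fin m) → List (Fin n ⊎ Fin m) → Set
Shuffle u v w = restrictA w ≡ u × restrictB w ≡ v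

Tensor : ∀ {n m} → (List (Fin n) → Set) → (List (Fin m) → Set) →
         List (Fin n) → List (Fin m) → List (Fin n ⊎ Fin m) → Set
Tensor D₁ D₂ u v w = Concat D₁ D₂ w ⊎ Shuffle u v w

-- Restricted to A, every order of (D₁ ⊗ D₂)(u,v) lies in D₁ (it is the A-part of a
-- concatenation, or u itself), and likewise for B; so on a triple inside A or inside B both
-- majorities and never conditions are inherited from D₁ or D₂. In a mixed triple {p, q, β}
-- with p above q in u, p is never ranked last: concatenations put β below p, shuffles put q
-- below p. Dually, in {p, q, α} with p above q in v, q is never ranked first. Hence every
-- mixed triple satisfies a never condition, which gives the peak-pit claim, and by Sen's
-- value-restriction argument forces the strict majority on that triple to be transitive.

module Submission where

open import Defs
open import Data.Nat using (ℕ; suc; _<_; _≤_; z≤n; s≤s)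
open import Data.Nat.Properties using (<-irrefl; <-asym; m≤n⇒m≤1+n; module ≤-Reasoning)
open import Data.Bool using (true; false)
open import Data.Fin using (Fin)
open import Data.Sum using (_⊎_; inj₁; inj₂; [_,_])
import Data.Sum as Sum
open import Data.Empty using (⊥-elim)
open import Data.List using (List; []; _∷_; _++_; map; length; allFin)
open import Data.List.Properties using (length-map)
open import Data.List.Relation.Unary.All using (All; []; _∷_)
import Data.List.Relation.Unary.All as All
open import Data.List.Relation.Unary.All.Properties using () renaming (map⁺ to All-map⁺)
open import Data.List.Relation.Unary.Any using (here; there)
open import Data.List.Membership.Propositional using (_∈_)
open import Data.List.Membership.Propositional.Properties using (∈-allFin; ∈-map⁺; ∈-++⁺ˡ; ∈-++⁺ʳ)
open import Data.List.Relation.Binary.Permutation.Propositional using (_↭_; ↭-sym; ↭-trans; prep)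
import Data.List.Relation.Binary.Permutation.Propositional as ↭
open import Data.List.Relation.Binary.Permutation.Propositional.Properties using (∈-resp-↭; ++⁺; shift; map⁺)
open import Data.Product using (_×_; _,_)
open import Relation.Binary.PropositionalEquality using (_≡_; _≢_; refl; sym; trans; cong; cong₂; subst)
open import Relation.Binary.Definitions using (DecidableEquality)
open import Relation.Nullary using (¬_; yes; no)
open import Function using (_∘_; id)

module LinearOrders {X : Set} (_≟_ : DecidableEquality X) where

  _≻⟨_⟩_ : X → List X → X → Set
  a ≻⟨ w ⟩ b = before _≟_ w a b ≡ true

  ∈-tail : ∀ {x y : X} {w} → y ≢ x → y ∈ x ∷ w → y ∈ w
  ∈-tail y≢x (here y≡x) = ⊥-elim (y≢x y≡x)
  ∈-tail y≢x (there y∈w) = y∈w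

  ∈⇒elem : ∀ {b w} → b ∈ w → elem _≟_ b w ≡ true
  ∈⇒elem {b} (here refl) with b ≟ b
  ... | yes _ = refl
  ... | no b≢b = ⊥-elim (b≢b refl)
  ∈⇒elem {b} {x ∷ _} (there b∈w) with b ≟ x
  ... | yes _ = refl
  ... | no _ = ∈⇒elem b∈w

  elem⇒∈ : ∀ {b} w → elem _≟_ b w ≡ true → b ∈ w
  elem⇒∈ {b} (x ∷ w) b∈w with b ≟ x
  ... | yes refl = here refl
  ... | no _ = there (elem⇒∈ w b∈w)

  ≻-∈ʳ : ∀ w {a b} → a ≻⟨ w ⟩ b → b ∈ w
  ≻-∈ʳ (x ∷ w) {a} {b} a≻b with x ≟ a | x ≟ b
  ... | yes _ | _ = there (elem⇒∈ w a≻b)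
  ... | no _ | no _ = there (≻-∈ʳ w a≻b)

  ≻-trans : ∀ w {a b c} → a ≻⟨ w ⟩ b → b ≻⟨ w ⟩ c → a ≻⟨ w ⟩ c
  ≻-trans (x ∷ w) {a} {b} {c} a≻b b≻c with x ≟ a | x ≟ b | x ≟ c
  ... | yes refl | yes refl | _ = b≻c
  ... | yes refl | no _ | yes refl with () ← b≻c
  ... | yes refl | no _ | no _ = ∈⇒elem (≻-∈ʳ w b≻c)
  ... | no _ | no _ | yes refl = b≻c
  ... | no _ | no _ | no _ = ≻-trans w a≻b b≻c

  ≻-asym : ∀ w {a b} → a ≢ b → a ≻⟨ w ⟩ b → ¬ b ≻⟨ w ⟩ a
  ≻-asym (x ∷ w) {a} {b} a≢b a≻b b≻a with x ≟ a | x ≟ b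
  ... | yes refl | yes refl = a≢b refl
  ... | no _ | no _ = ≻-asym w a≢b a≻b b≻a

  ≻-total : ∀ w {a b} → a ≢ b → a ∈ w → b ∈ w → a ≻⟨ w ⟩ b ⊎ b ≻⟨ w ⟩ a
  ≻-total (x ∷ w) {a} {b} a≢b a∈ b∈ with x ≟ a | x ≟ b
  ... | yes refl | yes refl = ⊥-elim (a≢b refl)
  ... | yes refl | no x≢b = inj₁ (∈⇒elem (∈-tail (x≢b ∘ sym) b∈))
  ... | no x≢a | yes refl = inj₂ (∈⇒elem (∈-tail (x≢a ∘ sym) a∈))
  ... | no x≢a | no x≢b = ≻-total w a≢b (∈-tail (x≢a ∘ sym) a∈) (∈-tail (x≢b ∘ sym) b∈)

  RanksAll : Domain _≟_ → Set
  RanksAll D = ∀ w → D w → ∀ (x : X) → x ∈ w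

  domainOn⇒ranksAll : ∀ {univ D} → IsDomainOn _≟_ univ D → (∀ x → x ∈ univ) → RanksAll D
  domainOn⇒ranksAll dom ∈univ w dw x = ∈-resp-↭ (↭-sym (dom w dw)) (∈univ x)

  support-mono : ∀ {D : Domain _≟_} {a b c d} → (∀ w → D w → a ≻⟨ w ⟩ b → c ≻⟨ w ⟩ d) →
                 ∀ P → All D P → support _≟_ P a b ≤ support _≟_ P c d
  support-mono f [] [] = z≤n
  support-mono {a = a} {b} {c} {d} f (w ∷ P) (dw ∷ Ps)
    with before _≟_ w a b in a≻b | before _≟_ w c d in c≻d
  ... | true  | true  = s≤s (support-mono f P Ps)
  ... | true  | false with () ← trans (sym (f w dw a≻b)) c≻d
  ... | false | true  = m≤n⇒m≤1+n (support-mono f P Ps)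
  ... | false | false = support-mono f P Ps

  Maj⇒≢ : ∀ {P} {a b : X} → Maj _≟_ P a b → a ≢ b
  Maj⇒≢ ab refl = <-irrefl refl ab

  Maj-Maj⇒≢ : ∀ {P} {a b c : X} → Maj _≟_ P a b → Maj _≟_ P b c → a ≢ c
  Maj-Maj⇒≢ ab bc refl = <-asym ab bc

  NeverTop⊎NeverBottom : Domain _≟_ → X → X → X → Set
  NeverTop⊎NeverBottom D x y z = NeverTop _≟_ D x y z ⊎ NeverBottom _≟_ D x y z

  neverTop-swap : ∀ {D : Domain _≟_} {x y z} → NeverTop _≟_ D x y z → NeverTop _≟_ D x z y
  neverTop-swap nt w dw (xy , xz) = nt w dw (xz , xy)

  neverBottom-swap : ∀ {D : Domain _≟_} {x y z} → NeverBottom _≟_ D x y z → NeverBottom _≟_ D x z y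
  neverBottom-swap nb w dw (yx , zx) = nb w dw (zx , yx)

  neverTop⊎neverBottom-swap : ∀ {D : Domain _≟_} {x y z} →
                              NeverTop⊎NeverBottom D x y z → NeverTop⊎NeverBottom D x z y
  neverTop⊎neverBottom-swap = Sum.map neverTop-swap neverBottom-swap

  peakPitTriple-swap₁₂ : ∀ {D : Domain _≟_} {a b c} →
                         PeakPitTriple _≟_ D a b c → PeakPitTriple _≟_ D b a c
  peakPitTriple-swap₁₂ (inj₁ na) = inj₂ (inj₁ na)
  peakPitTriple-swap₁₂ (inj₂ (inj₁ nb)) = inj₁ nb
  peakPitTriple-swap₁₂ (inj₂ (inj₂ nc)) = inj₂ (inj₂ (neverTop⊎neverBottom-swap nc))

  peakPitTriple-swap₂₃ : ∀ {D : Domain _≟_} {a b c} →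
                         PeakPitTriple _≟_ D a b c → PeakPitTriple _≟_ D a c b
  peakPitTriple-swap₂₃ (inj₁ na) = inj₁ (neverTop⊎neverBottom-swap na)
  peakPitTriple-swap₂₃ (inj₂ (inj₁ nb)) = inj₂ (inj₂ nb)
  peakPitTriple-swap₂₃ (inj₂ (inj₂ nc)) = inj₂ (inj₁ nc)

  -- No parity assumption is needed: each case chains two inequalities between supports,
  -- obtained from implications valid in every order of D, around the two given majorities.
  module ValueRestriction {D : Domain _≟_} (ranksAll : RanksAll D) where

    private
      total : ∀ {w x y} → D w → x ≢ y → x ≻⟨ w ⟩ y ⊎ y ≻⟨ w ⟩ x
      total {w} dw x≢y = ≻-total w x≢y (ranksAll w dw _) (ranksAll w dw _)

    neverBottom-above : ∀ {x y z} → x ≢ z → NeverBottom _≟_ D x y z →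
                        ∀ w → D w → y ≻⟨ w ⟩ x → y ≻⟨ w ⟩ z
    neverBottom-above x≢z nb w dw y≻x with total dw x≢z
    ... | inj₁ x≻z = ≻-trans w y≻x x≻z
    ... | inj₂ z≻x = ⊥-elim (nb w dw (y≻x , z≻x))

    neverBottom-below : ∀ {x y z} → x ≢ y → y ≢ z → x ≢ z → NeverBottom _≟_ D x y z →
                        ∀ w → D w → z ≻⟨ w ⟩ y → x ≻⟨ w ⟩ y
    neverBottom-below x≢y y≢z x≢z nb w dw z≻y with total dw x≢y
    ... | inj₁ x≻y = x≻y
    ... | inj₂ y≻x = ⊥-elim (≻-asym w y≢z (neverBottom-above x≢z nb w dw y≻x) z≻y)

    neverTop-below : ∀ {x y z} → x ≢ z → NeverTop _≟_ D x y z →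
                     ∀ w → D w → x ≻⟨ w ⟩ y → z ≻⟨ w ⟩ y
    neverTop-below x≢z nt w dw x≻y with total dw x≢z
    ... | inj₁ x≻z = ⊥-elim (nt w dw (x≻y , x≻z))
    ... | inj₂ z≻x = ≻-trans w z≻x x≻y

    neverTop-above : ∀ {x y z} → x ≢ y → y ≢ z → x ≢ z → NeverTop _≟_ D x y z →
                     ∀ w → D w → y ≻⟨ w ⟩ z → y ≻⟨ w ⟩ x
    neverTop-above x≢y y≢z x≢z nt w dw y≻z with total dw x≢y
    ... | inj₁ x≻y = ⊥-elim (≻-asym w y≢z y≻z (neverTop-below x≢z nt w dw x≻y))
    ... | inj₂ y≻x = y≻x

    module _ {a b c} (P : List (List X)) (Ps : All D P)
             (ab : Maj _≟_ P a b) (bc : Maj _≟_ P b c) where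

      private
        s : X → X → ℕ
        s = support _≟_ P

        mono : ∀ {p q r t} → (∀ w → D w → p ≻⟨ w ⟩ q → r ≻⟨ w ⟩ t) → s p q ≤ s r t
        mono f = support-mono f P Ps

        a≢b : a ≢ b
        a≢b = Maj⇒≢ {P} ab
        b≢c : b ≢ c
        b≢c = Maj⇒≢ {P} bc
        a≢c : a ≢ c
        a≢c = Maj-Maj⇒≢ {P} ab bc

      open ≤-Reasoning

      transitive-restrictedFirst : NeverTop⊎NeverBottom D a b c → Maj _≟_ P a c
      transitive-restrictedFirst (inj₁ nt) = ⊥-elim (<-irrefl refl (begin-strict
        s a b  ≤⟨ mono (neverTop-below a≢c nt) ⟩
        s c b  <⟨ bc ⟩
        s b c  ≤⟨ mono (neverTop-above a≢b b≢c a≢c nt) ⟩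
        s b a  <⟨ ab ⟩
        s a b  ∎))
      transitive-restrictedFirst (inj₂ nb) = begin-strict
        s c a  ≤⟨ mono (neverBottom-above a≢b (neverBottom-swap nb)) ⟩
        s c b  <⟨ bc ⟩
        s b c  ≤⟨ mono (neverBottom-below a≢c (b≢c ∘ sym) a≢b (neverBottom-swap nb)) ⟩
        s a c  ∎

      transitive-restrictedMiddle : NeverTop⊎NeverBottom D b a c → Maj _≟_ P a c
      transitive-restrictedMiddle (inj₁ nt) = begin-strict
        s c a  ≤⟨ mono (neverTop-above b≢c (a≢c ∘ sym) (a≢b ∘ sym) (neverTop-swap nt)) ⟩
        s c b  <⟨ bc ⟩
        s b c  ≤⟨ mono (neverTop-below (a≢b ∘ sym) (neverTop-swap nt)) ⟩
        s a c  ∎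
      transitive-restrictedMiddle (inj₂ nb) = begin-strict
        s c a  ≤⟨ mono (neverBottom-below (a≢b ∘ sym) a≢c b≢c nb) ⟩
        s b a  <⟨ ab ⟩
        s a b  ≤⟨ mono (neverBottom-above b≢c nb) ⟩
        s a c  ∎

      transitive-restrictedLast : NeverTop⊎NeverBottom D c a b → Maj _≟_ P a c
      transitive-restrictedLast (inj₁ nt) = begin-strict
        s c a  ≤⟨ mono (neverTop-below (b≢c ∘ sym) nt) ⟩
        s b a  <⟨ ab ⟩
        s a b  ≤⟨ mono (neverTop-above (a≢c ∘ sym) a≢b (b≢c ∘ sym) nt) ⟩
        s a c  ∎
      transitive-restrictedLast (inj₂ nb) = ⊥-elim (<-irrefl refl (begin-strict
        s b c  ≤⟨ mono (neverBottom-above (a≢c ∘ sym) (neverBottom-swap nb)) ⟩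
        s b a  <⟨ ab ⟩
        s a b  ≤⟨ mono (neverBottom-below (b≢c ∘ sym) (a≢b ∘ sym) (a≢c ∘ sym)
                                          (neverBottom-swap nb)) ⟩
        s c b  <⟨ bc ⟩
        s b c  ∎))

    peakPitTriple⇒transitive : ∀ {a b c} → PeakPitTriple _≟_ D a b c →
      ∀ P → All D P → Maj _≟_ P a b → Maj _≟_ P b c → Maj _≟_ P a c
    peakPitTriple⇒transitive ppt P Ps ab bc =
      [ transitive-restrictedFirst P Ps ab bc
      , [ transitive-restrictedMiddle P Ps ab bc , transitive-restrictedLast P Ps ab bc ] ] ppt

-- Odd mentions the decidable equality only as an unused module parameter.
Odd-cast : ∀ {Y Z : Set} {_≟Y_ : DecidableEquality Y} {_≟Z_ : DecidableEquality Z} {k} →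
           Odd _≟Y_ k → Odd _≟Z_ k
Odd-cast odd1 = odd1
Odd-cast (odd+2 odd) = odd+2 (Odd-cast odd)

module Restriction {Y Z : Set} (_≟Y_ : DecidableEquality Y) (_≟Z_ : DecidableEquality Z)
  (ι : Z → Y) (ρ : List Y → List Z)
  (before-ρ : ∀ w a b → before _≟Y_ w (ι a) (ι b) ≡ before _≟Z_ (ρ w) a b)
  {D : Domain _≟Y_} {E : Domain _≟Z_} (ρ-E : ∀ {w} → D w → E (ρ w)) where

  open LinearOrders _≟Y_ using () renaming (_≻⟨_⟩_ to _≻Y⟨_⟩_)
  open LinearOrders _≟Z_ using () renaming (_≻⟨_⟩_ to _≻Z⟨_⟩_)

  ≻-ρ : ∀ {w a b} → ι a ≻Y⟨ w ⟩ ι b → a ≻Z⟨ ρ w ⟩ b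
  ≻-ρ {w} {a} {b} = trans (sym (before-ρ w a b))

  support-ρ : ∀ P a b → support _≟Y_ P (ι a) (ι b) ≡ support _≟Z_ (map ρ P) a b
  support-ρ [] a b = refl
  support-ρ (w ∷ P) a b rewrite before-ρ w a b with before _≟Z_ (ρ w) a b
  ... | true  = cong suc (support-ρ P a b)
  ... | false = support-ρ P a b

  Maj-ρ : ∀ P a b → Maj _≟Y_ P (ι a) (ι b) ≡ Maj _≟Z_ (map ρ P) a b
  Maj-ρ P a b = cong₂ _<_ (support-ρ P b a) (support-ρ P a b)

  condorcet-ρ : Condorcet _≟Z_ E → ∀ P → All D P → Odd _≟Y_ (length P) →
    ∀ a b c → Maj _≟Y_ P (ι a) (ι b) → Maj _≟Y_ P (ι b) (ι c) → Maj _≟Y_ P (ι a) (ι c)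
  condorcet-ρ condorcet P Ps odd a b c ab bc =
    subst id (sym (Maj-ρ P a c))
      (condorcet (map ρ P) (All-map⁺ (All.map ρ-E Ps))
        (subst (Odd _≟Z_) (sym (length-map ρ P)) (Odd-cast odd))
        a b c (subst id (Maj-ρ P a b) ab) (subst id (Maj-ρ P b c) bc))

  neverTop-ρ : ∀ {x y z} → NeverTop _≟Z_ E x y z → NeverTop _≟Y_ D (ι x) (ι y) (ι z)
  neverTop-ρ nt w dw (xy , xz) = nt (ρ w) (ρ-E dw) (≻-ρ {w} xy , ≻-ρ {w} xz)

  neverBottom-ρ : ∀ {x y z} → NeverBottom _≟Z_ E x y z → NeverBottom _≟Y_ D (ι x) (ι y) (ι z)
  neverBottom-ρ nb w dw (yx , zx) = nb (ρ w) (ρ-E dw) (≻-ρ {w} yx , ≻-ρ {w} zx)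

  peakPitTriple-ρ : ∀ {a b c} → PeakPitTriple _≟Z_ E a b c → PeakPitTriple _≟Y_ D (ι a) (ι b) (ι c)
  peakPitTriple-ρ = Sum.map never-ρ (Sum.map never-ρ never-ρ)
    where
    never-ρ : ∀ {x y z} → NeverTop _≟Z_ E x y z ⊎ NeverBottom _≟Z_ E x y z →
              NeverTop _≟Y_ D (ι x) (ι y) (ι z) ⊎ NeverBottom _≟Y_ D (ι x) (ι y) (ι z)
    never-ρ = Sum.map neverTop-ρ neverBottom-ρ

module _ {n m : ℕ} where

  elem-restrictA : ∀ (w : List (Fin n ⊎ Fin m)) b → elem _≟AB_ (inj₁ b) w ≡ elem _≟F_ b (restrictA w)
  elem-restrictA [] b = refl
  elem-restrictA (inj₁ x ∷ w) b with b ≟F x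
  ... | yes _ = refl
  ... | no _ = elem-restrictA w b
  elem-restrictA (inj₂ _ ∷ w) b = elem-restrictA w b

  elem-restrictB : ∀ (w : List (Fin n ⊎ Fin m)) b → elem _≟AB_ (inj₂ b) w ≡ elem _≟F_ b (restrictB w)
  elem-restrictB [] b = refl
  elem-restrictB (inj₁ _ ∷ w) b = elem-restrictB w b
  elem-restrictB (inj₂ x ∷ w) b with b ≟F x
  ... | yes _ = refl
  ... | no _ = elem-restrictB w b

  before-restrictA : ∀ (w : List (Fin n ⊎ Fin m)) a b →
                     before _≟AB_ w (inj₁ a) (inj₁ b) ≡ before _≟F_ (restrictA w) a b
  before-restrictA [] a b = refl
  before-restrictA (inj₁ x ∷ w) a b with x ≟F a | x ≟F b
  ... | yes _ | _ = elem-restrictA w b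
  ... | no _ | yes _ = refl
  ... | no _ | no _ = before-restrictA w a b
  before-restrictA (inj₂ _ ∷ w) a b = before-restrictA w a b

  before-restrictB : ∀ (w : List (Fin n ⊎ Fin m)) a b →
                     before _≟AB_ w (inj₂ a) (inj₂ b) ≡ before _≟F_ (restrictB w) a b
  before-restrictB [] a b = refl
  before-restrictB (inj₁ _ ∷ w) a b = before-restrictB w a b
  before-restrictB (inj₂ x ∷ w) a b with x ≟F a | x ≟F b
  ... | yes _ | _ = elem-restrictB w b
  ... | no _ | yes _ = refl
  ... | no _ | no _ = before-restrictB w a b

  restrictA-concat : ∀ (x : List (Fin n)) (y : List (Fin m)) → restrictA (map inj₁ x ++ map inj₂ y) ≡ x
  restrictA-concat [] [] = refl
  restrictA-concat [] (_ ∷ y) = restrictA-concat [] y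
  restrictA-concat (a ∷ x) y = cong (a ∷_) (restrictA-concat x y)

  restrictB-concat : ∀ (x : List (Fin n)) (y : List (Fin m)) → restrictB (map inj₁ x ++ map inj₂ y) ≡ y
  restrictB-concat [] [] = refl
  restrictB-concat [] (b ∷ y) = cong (b ∷_) (restrictB-concat [] y)
  restrictB-concat (_ ∷ x) y = restrictB-concat x y

  ↭-restrictA++restrictB : ∀ (w : List (Fin n ⊎ Fin m)) →
                           w ↭ map inj₁ (restrictA w) ++ map inj₂ (restrictB w)
  ↭-restrictA++restrictB [] = ↭.refl
  ↭-restrictA++restrictB (inj₁ a ∷ w) = prep _ (↭-restrictA++restrictB w)
  ↭-restrictA++restrictB (inj₂ b ∷ w) = ↭-trans (prep _ (↭-restrictA++restrictB w))
    (↭-sym (shift (inj₂ b) (map inj₁ (restrictA w)) (map inj₂ (restrictB w))))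

  ∈-univAB : ∀ (x : Fin n ⊎ Fin m) → x ∈ univAB n m
  ∈-univAB (inj₁ a) = ∈-++⁺ˡ (∈-map⁺ inj₁ (∈-allFin a))
  ∈-univAB (inj₂ b) = ∈-++⁺ʳ _ (∈-map⁺ inj₂ (∈-allFin b))

  inj₁∉map-inj₂ : ∀ a (y : List (Fin m)) → ¬ elem (_≟AB_ {n}) (inj₁ a) (map inj₂ y) ≡ true
  inj₁∉map-inj₂ a [] ()
  inj₁∉map-inj₂ a (_ ∷ y) = inj₁∉map-inj₂ a y

  concat-¬inj₂≻inj₁ : ∀ (x : List (Fin n)) (y : List (Fin m)) a b →
                      ¬ before _≟AB_ (map inj₁ x ++ map inj₂ y) (inj₂ b) (inj₁ a) ≡ true
  concat-¬inj₂≻inj₁ [] [] a b ()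
  concat-¬inj₂≻inj₁ [] (y₀ ∷ y) a b with y₀ ≟F b
  ... | yes _ = inj₁∉map-inj₂ a y
  ... | no _ = concat-¬inj₂≻inj₁ [] y a b
  concat-¬inj₂≻inj₁ (x₀ ∷ x) y a b with x₀ ≟F a
  ... | yes _ = λ ()
  ... | no _ = concat-¬inj₂≻inj₁ x y a b

module TensorDomain (n m : ℕ) (D₁ : List (Fin n) → Set) (D₂ : List (Fin m) → Set)
  (dom₁ : IsDomainOn _≟F_ (allFin n) D₁) (dom₂ : IsDomainOn _≟F_ (allFin m) D₂)
  (u : List (Fin n)) (v : List (Fin m)) (u∈D₁ : D₁ u) (v∈D₂ : D₂ v) where

  AB : Set
  AB = Fin n ⊎ Fin m

  T : List AB → Set
  T = Tensor D₁ D₂ u v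

  open LinearOrders (_≟AB_ {n} {m})
  open LinearOrders (_≟F_ {n}) using ()
    renaming (_≻⟨_⟩_ to _≻A⟨_⟩_; ≻-total to ≻A-total; ≻-asym to ≻A-asym)
  open LinearOrders (_≟F_ {m}) using ()
    renaming (_≻⟨_⟩_ to _≻B⟨_⟩_; ≻-total to ≻B-total; ≻-asym to ≻B-asym)

  restrictA-T : ∀ {w} → T w → D₁ (restrictA w)
  restrictA-T (inj₁ (x , y , x∈D₁ , _ , refl)) = subst D₁ (sym (restrictA-concat x y)) x∈D₁
  restrictA-T (inj₂ (w|A≡u , _)) = subst D₁ (sym w|A≡u) u∈D₁

  restrictB-T : ∀ {w} → T w → D₂ (restrictB w)
  restrictB-T (inj₁ (x , y , _ , y∈D₂ , refl)) = subst D₂ (sym (restrictB-concat x y)) y∈D₂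
  restrictB-T (inj₂ (_ , w|B≡v)) = subst D₂ (sym w|B≡v) v∈D₂

  module RA = Restriction _≟AB_ _≟F_ inj₁ restrictA before-restrictA {T} {D₁} restrictA-T
  module RB = Restriction _≟AB_ _≟F_ inj₂ restrictB before-restrictB {T} {D₂} restrictB-T

  T-domainOn : IsDomainOn _≟AB_ (univAB n m) T
  T-domainOn _ (inj₁ (x , y , x∈D₁ , y∈D₂ , refl)) =
    ++⁺ (map⁺ inj₁ (dom₁ x x∈D₁)) (map⁺ inj₂ (dom₂ y y∈D₂))
  T-domainOn w (inj₂ shuffle) = ↭-trans (↭-restrictA++restrictB w)
    (++⁺ (map⁺ inj₁ (dom₁ _ (restrictA-T {w} (inj₂ shuffle))))
         (map⁺ inj₂ (dom₂ _ (restrictB-T {w} (inj₂ shuffle)))))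

  u-total : ∀ {a b} → a ≢ b → a ≻A⟨ u ⟩ b ⊎ b ≻A⟨ u ⟩ a
  u-total a≢b = ≻A-total u a≢b (u-ranksAll _) (u-ranksAll _)
    where u-ranksAll = LinearOrders.domainOn⇒ranksAll _≟F_ dom₁ ∈-allFin u u∈D₁

  v-total : ∀ {a b} → a ≢ b → a ≻B⟨ v ⟩ b ⊎ b ≻B⟨ v ⟩ a
  v-total a≢b = ≻B-total v a≢b (v-ranksAll _) (v-ranksAll _)
    where v-ranksAll = LinearOrders.domainOn⇒ranksAll _≟F_ dom₂ ∈-allFin v v∈D₂

  neverBottom-mixedA : ∀ {p q} (β : Fin m) → p ≢ q → p ≻A⟨ u ⟩ q →
                       NeverBottom _≟AB_ T (inj₁ p) (inj₁ q) (inj₂ β)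
  neverBottom-mixedA β _ _ _ (inj₁ (x , y , _ , _ , refl)) (_ , β≻p) = concat-¬inj₂≻inj₁ x y _ β β≻p
  neverBottom-mixedA {p} {q} β p≢q p≻q w (inj₂ (w|A≡u , _)) (q≻p , _) =
    ≻A-asym u p≢q p≻q (subst (λ r → q ≻A⟨ r ⟩ p) w|A≡u (RA.≻-ρ {w} q≻p))

  neverTop-mixedB : ∀ {p q} (α : Fin n) → p ≢ q → p ≻B⟨ v ⟩ q →
                    NeverTop _≟AB_ T (inj₂ q) (inj₂ p) (inj₁ α)
  neverTop-mixedB α _ _ _ (inj₁ (x , y , _ , _ , refl)) (_ , q≻α) = concat-¬inj₂≻inj₁ x y α _ q≻α
  neverTop-mixedB {p} {q} α p≢q p≻q w (inj₂ (_ , w|B≡v)) (q≻p , _) =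
    ≻B-asym v p≢q p≻q (subst (λ r → q ≻B⟨ r ⟩ p) w|B≡v (RB.≻-ρ {w} q≻p))

  peakPitTriple-AAB : ∀ a b (γ : Fin m) → a ≢ b → PeakPitTriple _≟AB_ T (inj₁ a) (inj₁ b) (inj₂ γ)
  peakPitTriple-AAB a b γ a≢b with u-total a≢b
  ... | inj₁ a≻b = inj₁ (inj₂ (neverBottom-mixedA γ a≢b a≻b))
  ... | inj₂ b≻a = inj₂ (inj₁ (inj₂ (neverBottom-mixedA γ (a≢b ∘ sym) b≻a)))

  peakPitTriple-BBA : ∀ a b (γ : Fin n) → a ≢ b → PeakPitTriple _≟AB_ T (inj₂ a) (inj₂ b) (inj₁ γ)
  peakPitTriple-BBA a b γ a≢b with v-total a≢b
  ... | inj₁ a≻b = inj₂ (inj₁ (inj₁ (neverTop-mixedB γ a≢b a≻b)))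
  ... | inj₂ b≻a = inj₁ (inj₁ (neverTop-mixedB γ (a≢b ∘ sym) b≻a))

  data TripleView : AB → AB → AB → Set where
    inA   : ∀ a b c → TripleView (inj₁ a) (inj₁ b) (inj₁ c)
    inB   : ∀ a b c → TripleView (inj₂ a) (inj₂ b) (inj₂ c)
    mixed : ∀ {x y z} → PeakPitTriple _≟AB_ T x y z → TripleView x y z

  tripleView : ∀ x y z → x ≢ y → y ≢ z → x ≢ z → TripleView x y z
  tripleView (inj₁ a) (inj₁ b) (inj₁ c) _ _ _ = inA a b c
  tripleView (inj₂ a) (inj₂ b) (inj₂ c) _ _ _ = inB a b c
  tripleView (inj₁ a) (inj₁ b) (inj₂ γ) x≢y _ _ =
    mixed (peakPitTriple-AAB a b γ (x≢y ∘ cong inj₁))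
  tripleView (inj₁ a) (inj₂ β) (inj₁ c) _ _ x≢z =
    mixed (peakPitTriple-swap₂₃ (peakPitTriple-AAB a c β (x≢z ∘ cong inj₁)))
  tripleView (inj₂ α) (inj₁ b) (inj₁ c) _ y≢z _ =
    mixed (peakPitTriple-swap₁₂ (peakPitTriple-swap₂₃ (peakPitTriple-AAB b c α (y≢z ∘ cong inj₁))))
  tripleView (inj₂ a) (inj₂ b) (inj₁ γ) x≢y _ _ =
    mixed (peakPitTriple-BBA a b γ (x≢y ∘ cong inj₂))
  tripleView (inj₂ a) (inj₁ β) (inj₂ c) _ _ x≢z =
    mixed (peakPitTriple-swap₂₃ (peakPitTriple-BBA a c β (x≢z ∘ cong inj₂)))
  tripleView (inj₁ α) (inj₂ b) (inj₂ c) _ y≢z _ =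
    mixed (peakPitTriple-swap₁₂ (peakPitTriple-swap₂₃ (peakPitTriple-BBA b c α (y≢z ∘ cong inj₂))))

  T-condorcet : Condorcet _≟F_ D₁ → Condorcet _≟F_ D₂ → Condorcet _≟AB_ T
  T-condorcet c₁ c₂ P Ps odd x y z xy yz
    with tripleView x y z (Maj⇒≢ {P} xy) (Maj⇒≢ {P} yz) (Maj-Maj⇒≢ {P} xy yz)
  ... | inA a b c = RA.condorcet-ρ c₁ P Ps odd a b c xy yz
  ... | inB a b c = RB.condorcet-ρ c₂ P Ps odd a b c xy yz
  ... | mixed ppt = ValueRestriction.peakPitTriple⇒transitive
                      (domainOn⇒ranksAll T-domainOn ∈-univAB) ppt P Ps xy yz

  T-peakPit : PeakPit _≟F_ D₁ → PeakPit _≟F_ D₂ → PeakPit _≟AB_ T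
  T-peakPit pp₁ pp₂ x y z x≢y y≢z x≢z with tripleView x y z x≢y y≢z x≢z
  ... | inA a b c = RA.peakPitTriple-ρ
                      (pp₁ a b c (x≢y ∘ cong inj₁) (y≢z ∘ cong inj₁) (x≢z ∘ cong inj₁))
  ... | inB a b c = RB.peakPitTriple-ρ
                      (pp₂ a b c (x≢y ∘ cong inj₂) (y≢z ∘ cong inj₂) (x≢z ∘ cong inj₂))
  ... | mixed ppt = ppt

theorem1 : (n m : ℕ) (D₁ : List (Fin n) → Set) (D₂ : List (Fin m) → Set) →
    IsDomainOn _≟F_ (allFin n) D₁ → IsDomainOn _≟F_ (allFin m) D₂ →
    Condorcet _≟F_ D₁ → Condorcet _≟F_ D₂ →
    (u : List (Fin n)) (v : List (Fin m)) → D₁ u → D₂ v →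
    (IsDomainOn _≟AB_ (univAB n m) (Tensor D₁ D₂ u v) ×
     Condorcet _≟AB_ (Tensor D₁ D₂ u v)) ×
    (PeakPit _≟F_ D₁ → PeakPit _≟F_ D₂ → PeakPit _≟AB_ (Tensor D₁ D₂ u v))
theorem1 n m D₁ D₂ dom₁ dom₂ c₁ c₂ u v u∈D₁ v∈D₂ =
  (T-domainOn , T-condorcet c₁ c₂) , T-peakPit
  where open TensorDomain n m D₁ D₂ dom₁ dom₂ u v u∈D₁ v∈D₂
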